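{- The triple $(\mathsf{P}_S,\eta,-^*)$ is a $\mathbf{Po}$-enriched monad on $\mathbf{Met}_Q$, i.e.: \begin{enumerate} \item $(\mathsf{P}(X),d_S)$ is an object of $\mathbf{Met}_Q$, i.e., $\mathbb{1}\sqsubseteq d_S(A,A)$ and $d_S(A,B)\otimes d_S(B,C)\sqsubseteq d_S(A,C)$. \item $\eta:\mathbf{Met}_Q(X,\mathsf{P}_S(X))$. \item $f:\mathbf{Met}_Q(X,\mathsf{P}_S(X'))$ implies $f^*:\mathbf{Met}_Q(\mathsf{P}_S(X),\mathsf{P}_S(X'))$. \item $f\leq g$ in $\mathbf{Met}_Q(X,\mathsf{P}_S(X'))$ implies $f^*\leq g^*$ in $\mathbf{Met}_Q(\mathsf{P}_S(X),\mathsf{P}_S(X'))$. \end{enumerate} Moreover, $(\mathsf{P}_S,\eta,-^*)$ satisfies the monad equations $\eta_X^*=\mathrm{id}_{\mathsf{P}_S X}$, $f^*\circ\eta_X=f$, and $g^*\circ f^*=(g^*\circ f)^*$.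
   Context: Let $(Q,\sqsubseteq,\otimes)$ be a quantale (a complete lattice with a monoid structure $(Q,\otimes,\mathbb{1})$ where $\otimes$ distributes over arbitrary joins $\bigsqcup$ on both sides). $\mathbf{Met}_Q$ is the $\mathbf{Po}$-enriched category whose objects are $Q$-metric spaces $(X,d)$ with $d:X^2\to Q$ satisfying $d(x,y)\otimes d(y,z)\sqsubseteq d(x,z)$ and $\mathbb{1}\sqsubseteq d(x,x)$, and whose arrows $f:(X,d)\to(X',d')$ are short maps, i.e., $f:X\to X'$ with $d(x,y)\sqsubseteq d'(f(x),f(y))$ for all $x,y$; the hom-preorder is $f\leq f'$ iff $\mathbb{1}\sqsubseteq d'(f(x),f'(x))$ for all $x\in X$. For a $Q$-metric space $(X,d)$, define $\mathsf{P}_S(X,d)=(\mathsf{P}(X),d_S)$, where $\mathsf{P}(X)$ is the powerset and $$d_S(A,B)=\sqcap_{y \in B}\textstyle\bigsqcup_{x \in A}d(x,y)$$ (here $\sqcap_{y\in B}$ denotes the meet in $Q$ over $y\in B$). The unit and Kleisli extension are those of the powerset monad on $\mathbf{Set}$: $\eta_X(x)=\{x\}$ and, for $f:X\to\mathsf{P}(X')$, $f^*(A)=\bigcup_{x\in A}f(x)$. -}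

module Defs where

open import Level using (0ℓ; Level; _⊔_)
open import Data.Product using (Σ; Σ-syntax; _×_; _,_; proj₁; proj₂)
open import Relation.Binary.PropositionalEquality using (_≡_)
open import Relation.Unary using (Pred; _≐_)

record Quantale : Set₁ where
  infix  4 _⊑_
  infixl 7 _⊗_
  field
    Carrier   : Set
    _⊑_       : Carrier → Carrier → Set
    ⊑-refl    : ∀ {a} → a ⊑ a
    ⊑-trans   : ∀ {a b c} → a ⊑ b → b ⊑ c → a ⊑ c
    ⊑-antisym : ∀ {a b} → a ⊑ b → b ⊑ a → a ≡ b
    ⨆         : {I : Set} → (I → Carrier) → Carrier
    ⨆-upper   : ∀ {I : Set} (f : I → Carrier) (i : I) → f i ⊑ ⨆ f
    ⨆-least   : ∀ {I : Set} (f : I → Carrier) (a : Carrier) →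
                (∀ i → f i ⊑ a) → ⨆ f ⊑ a
    ⨅         : {I : Set} → (I → Carrier) → Carrier
    ⨅-lower   : ∀ {I : Set} (f : I → Carrier) (i : I) → ⨅ f ⊑ f i
    ⨅-greatest : ∀ {I : Set} (f : I → Carrier) (a : Carrier) →
                (∀ i → a ⊑ f i) → a ⊑ ⨅ f
    _⊗_       : Carrier → Carrier → Carrier
    𝟙         : Carrier
    ⊗-assoc   : ∀ a b c → (a ⊗ b) ⊗ c ≡ a ⊗ (b ⊗ c)
    ⊗-identityˡ : ∀ a → 𝟙 ⊗ a ≡ a
    ⊗-identityʳ : ∀ a → a ⊗ 𝟙 ≡ a
    ⊗-distribˡ-⨆ : ∀ {I : Set} (a : Carrier) (f : I → Carrier) →
                   a ⊗ ⨆ f ≡ ⨆ (λ i → a ⊗ f i)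
    ⊗-distribʳ-⨆ : ∀ {I : Set} (f : I → Carrier) (a : Carrier) →
                   ⨆ f ⊗ a ≡ ⨆ (λ i → f i ⊗ a)

module _ (Q : Quantale) where
  open Quantale Q

  record IsQMetric {a} {X : Set a} (d : X → X → Carrier) : Set a where
    field
      reflexive  : ∀ x → 𝟙 ⊑ d x x
      transitive : ∀ x y z → d x y ⊗ d y z ⊑ d x z

  IsShort : ∀ {a b} {X : Set a} {X' : Set b} → (X → X → Carrier) → (X' → X' → Carrier) →
            (X → X') → Set a
  IsShort d d' f = ∀ x y → d x y ⊑ d' (f x) (f y)

  HomLeq : ∀ {a b} {X : Set a} {X' : Set b} → (X' → X' → Carrier) → (X → X') → (X → X') → Set a
  HomLeq d' f f' = ∀ x → 𝟙 ⊑ d' (f x) (f' x)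

  dS : {X : Set} → (X → X → Carrier) → Pred X 0ℓ → Pred X 0ℓ → Carrier
  dS {X} d A B = ⨅ {Σ[ y ∈ X ] B y} (λ yb → ⨆ {Σ[ x ∈ X ] A x} (λ xa → d (proj₁ xa) (proj₁ yb)))

η : {X : Set} → X → Pred X 0ℓ
η x = λ y → x ≡ y

_* : {X X' : Set} → (X → Pred X' 0ℓ) → Pred X 0ℓ → Pred X' 0ℓ
(f *) A = λ y → Σ[ x ∈ _ ] (A x × f x y)

-- Write d(A, y) = ⨆_{x ∈ A} d(x, y), so that d_S(A, B) = ⨅_{y ∈ B} d(A, y).
-- Since ⊗ distributes over joins, the triangle inequality lifts to
-- d(A, y) ⊗ d(y, z) ⊑ d(A, z) and then to d_S(A, B) ⊗ d(B, z) ⊑ d(A, z),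
-- which gives transitivity of d_S. Everything else rests on d(A, y) growing
-- with A, together with f(x) ⊆ f*(A) for x ∈ A.
module Submission where

open import Defs
open import Level using (0ℓ)
open import Data.Bool using (Bool; true; false)
open import Data.Product using (Σ; _×_; _,_; proj₁)
open import Relation.Binary.Bundles using (Preorder)
open import Relation.Binary.PropositionalEquality
  using (_≡_; refl; sym; cong; isEquivalence)
open import Relation.Unary using (Pred; _⊆_; _≐_)

module QuantaleProperties (Q : Quantale) where
  open Quantale Q

  ⊑-preorder : Preorder 0ℓ 0ℓ 0ℓ
  ⊑-preorder = record
    { Carrier    = Carrier
    ; _≈_        = _≡_
    ; _≲_        = _⊑_
    ; isPreorder = record
      { isEquivalence = isEquivalence
      ; reflexive     = λ { refl → ⊑-refl }
      ; trans         = ⊑-trans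
      }
    }

  open import Relation.Binary.Reasoning.Preorder ⊑-preorder public

  ⨆-mono : ∀ {I : Set} {f g : I → Carrier} → (∀ i → f i ⊑ g i) → ⨆ f ⊑ ⨆ g
  ⨆-mono {f = f} {g} f⊑g = ⨆-least f (⨆ g) (λ i → ⊑-trans (f⊑g i) (⨆-upper g i))

  ⊗-⨆-least : ∀ {I : Set} {a b : Carrier} (f : I → Carrier) →
              (∀ i → a ⊗ f i ⊑ b) → a ⊗ ⨆ f ⊑ b
  ⊗-⨆-least {a = a} {b} f h = begin
    a ⊗ ⨆ f             ≡⟨ ⊗-distribˡ-⨆ a f ⟩
    ⨆ (λ i → a ⊗ f i)   ≲⟨ ⨆-least _ b h ⟩
    b                   ∎

  ⨆-⊗-least : ∀ {I : Set} {a b : Carrier} (f : I → Carrier) →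
              (∀ i → f i ⊗ a ⊑ b) → ⨆ f ⊗ a ⊑ b
  ⨆-⊗-least {a = a} {b} f h = begin
    ⨆ f ⊗ a             ≡⟨ ⊗-distribʳ-⨆ f a ⟩
    ⨆ (λ i → f i ⊗ a)   ≲⟨ ⨆-least _ b h ⟩
    b                   ∎

  -- Monotonicity of ⊗ is not an axiom: a ⊑ b makes b the join of a and b.
  private
    pair : Carrier → Carrier → Bool → Carrier
    pair a b true  = a
    pair a b false = b

    ⨆-pair : ∀ {a b} → a ⊑ b → ⨆ (pair a b) ≡ b
    ⨆-pair {a} {b} a⊑b = ⊑-antisym
      (⨆-least (pair a b) b λ { true → a⊑b ; false → ⊑-refl })
      (⨆-upper (pair a b) false)

  ⊗-monoʳ : ∀ a {b c} → b ⊑ c → a ⊗ b ⊑ a ⊗ c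
  ⊗-monoʳ a {b} {c} b⊑c = begin
    a ⊗ b                      ≲⟨ ⨆-upper (λ i → a ⊗ pair b c i) true ⟩
    ⨆ (λ i → a ⊗ pair b c i)   ≡⟨ sym (⊗-distribˡ-⨆ a (pair b c)) ⟩
    a ⊗ ⨆ (pair b c)           ≡⟨ cong (a ⊗_) (⨆-pair b⊑c) ⟩
    a ⊗ c                      ∎

  ⊗-monoˡ : ∀ {a b} c → a ⊑ b → a ⊗ c ⊑ b ⊗ c
  ⊗-monoˡ {a} {b} c a⊑b = begin
    a ⊗ c                      ≲⟨ ⨆-upper (λ i → pair a b i ⊗ c) true ⟩
    ⨆ (λ i → pair a b i ⊗ c)   ≡⟨ sym (⊗-distribʳ-⨆ (pair a b) c) ⟩
    ⨆ (pair a b) ⊗ c           ≡⟨ cong (_⊗ c) (⨆-pair a⊑b) ⟩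
    b ⊗ c                      ∎

module HausdorffDistance (Q : Quantale) where
  open Quantale Q
  open QuantaleProperties Q

  module _ {X : Set} (d : X → X → Carrier) where

    distFrom : Pred X 0ℓ → X → Carrier
    distFrom A y = ⨆ {Σ X A} (λ xa → d (proj₁ xa) y)

    distFrom-upper : ∀ {A x} y → A x → d x y ⊑ distFrom A y
    distFrom-upper y x∈A = ⨆-upper (λ xa → d (proj₁ xa) y) (_ , x∈A)

    distFrom-least : ∀ {A y a} → (∀ {x} → A x → d x y ⊑ a) → distFrom A y ⊑ a
    distFrom-least h = ⨆-least _ _ (λ { (_ , x∈A) → h x∈A })

    distFrom-mono : ∀ {A A'} y → A ⊆ A' → distFrom A y ⊑ distFrom A' y
    distFrom-mono y A⊆A' = distFrom-least (λ x∈A → distFrom-upper y (A⊆A' x∈A))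

    dS-lower : ∀ {A B y} → B y → dS Q d A B ⊑ distFrom A y
    dS-lower y∈B = ⨅-lower _ (_ , y∈B)

    dS-greatest : ∀ {A B a} → (∀ {y} → B y → a ⊑ distFrom A y) → a ⊑ dS Q d A B
    dS-greatest h = ⨅-greatest _ _ (λ { (_ , y∈B) → h y∈B })

    module _ (isMetric : IsQMetric Q d) where
      open IsQMetric isMetric

      distFrom-⊗-transitive : ∀ A y z → distFrom A y ⊗ d y z ⊑ distFrom A z
      distFrom-⊗-transitive A y z = ⨆-⊗-least _ (λ { (x , x∈A) →
        ⊑-trans (transitive x y z) (distFrom-upper z x∈A) })

      dS-⊗-transitive : ∀ A B z → dS Q d A B ⊗ distFrom B z ⊑ distFrom A z
      dS-⊗-transitive A B z = ⊗-⨆-least _ (λ { (y , y∈B) → begin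
        dS Q d A B ⊗ d y z       ≲⟨ ⊗-monoˡ (d y z) (dS-lower y∈B) ⟩
        distFrom A y ⊗ d y z     ≲⟨ distFrom-⊗-transitive A y z ⟩
        distFrom A z             ∎ })

      dS-isQMetric : IsQMetric Q (dS Q d)
      dS-isQMetric = record
        { reflexive  = λ A → dS-greatest (λ {y} y∈A →
            ⊑-trans (reflexive y) (distFrom-upper y y∈A))
        ; transitive = λ A B C → dS-greatest (λ {z} z∈C → begin
            dS Q d A B ⊗ dS Q d B C     ≲⟨ ⊗-monoʳ (dS Q d A B) (dS-lower z∈C) ⟩
            dS Q d A B ⊗ distFrom B z   ≲⟨ dS-⊗-transitive A B z ⟩
            distFrom A z                ∎)
        }

    η-short : IsShort Q d (dS Q d) η
    η-short x y = dS-greatest (λ { refl → distFrom-upper y refl })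

*-⊇ : ∀ {X X' : Set} (f : X → Pred X' 0ℓ) {A x} → A x → f x ⊆ (f *) A
*-⊇ f x∈A z∈fx = _ , x∈A , z∈fx

η-* : ∀ {X : Set} (A : Pred X 0ℓ) → (η *) A ≐ A
η-* A = (λ { (_ , x∈A , refl) → x∈A }) , (λ x∈A → _ , x∈A , refl)

*-η : ∀ {X X' : Set} (f : X → Pred X' 0ℓ) (x : X) → (f *) (η x) ≐ f x
*-η f x = (λ { (_ , refl , z∈fx) → z∈fx }) , (λ z∈fx → x , refl , z∈fx)

*-assoc : ∀ {X X' X'' : Set} (f : X → Pred X' 0ℓ) (g : X' → Pred X'' 0ℓ) (A : Pred X 0ℓ) →
          (g *) ((f *) A) ≐ ((λ x → (g *) (f x)) *) A
*-assoc f g A =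
    (λ { (y , (x , x∈A , y∈fx) , z∈gy) → x , x∈A , y , y∈fx , z∈gy })
  , (λ { (x , x∈A , y , y∈fx , z∈gy) → y , (x , x∈A , y∈fx) , z∈gy })

module KleisliExtension (Q : Quantale) where
  open Quantale Q
  open QuantaleProperties Q
  open HausdorffDistance Q

  module _ {X X' : Set} (d : X → X → Carrier) (d' : X' → X' → Carrier) where

    *-short : (f : X → Pred X' 0ℓ) → IsShort Q d (dS Q d') f →
              IsShort Q (dS Q d) (dS Q d') (f *)
    *-short f f-short A B = dS-greatest d' (λ { {z} (y , y∈B , z∈fy) → begin
      dS Q d A B              ≲⟨ dS-lower d y∈B ⟩
      distFrom d A y          ≲⟨ distFrom-least d (λ {x} x∈A → begin
        d x y                   ≲⟨ f-short x y ⟩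
        dS Q d' (f x) (f y)     ≲⟨ dS-lower d' z∈fy ⟩
        distFrom d' (f x) z     ≲⟨ distFrom-mono d' z (*-⊇ f x∈A) ⟩
        distFrom d' ((f *) A) z ∎) ⟩
      distFrom d' ((f *) A) z ∎ })

  module _ {X X' : Set} (d' : X' → X' → Carrier) where

    *-monotone : (f g : X → Pred X' 0ℓ) →
                 HomLeq Q (dS Q d') f g → HomLeq Q (dS Q d') (f *) (g *)
    *-monotone f g f≤g A = dS-greatest d' (λ { {z} (x , x∈A , z∈gx) → begin
      𝟙                       ≲⟨ f≤g x ⟩
      dS Q d' (f x) (g x)     ≲⟨ dS-lower d' z∈gx ⟩
      distFrom d' (f x) z     ≲⟨ distFrom-mono d' z (*-⊇ f x∈A) ⟩
      distFrom d' ((f *) A) z ∎ })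

proposition9 : (Q : Quantale) →
    (∀ (X : Set) (d : X → X → Quantale.Carrier Q) →
    IsQMetric Q d → IsQMetric Q (dS Q d))
    × (∀ (X : Set) (d : X → X → Quantale.Carrier Q) →
    IsQMetric Q d → IsShort Q d (dS Q d) η)
    × (∀ (X X' : Set) (d : X → X → Quantale.Carrier Q) (d' : X' → X' → Quantale.Carrier Q) →
    IsQMetric Q d → IsQMetric Q d' →
    (f : X → Pred X' 0ℓ) → IsShort Q d (dS Q d') f →
    IsShort Q (dS Q d) (dS Q d') (f *))
    × (∀ (X X' : Set) (d : X → X → Quantale.Carrier Q) (d' : X' → X' → Quantale.Carrier Q) →
    IsQMetric Q d → IsQMetric Q d' →
    (f g : X → Pred X' 0ℓ) → IsShort Q d (dS Q d') f → IsShort Q d (dS Q d') g →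
    HomLeq Q (dS Q d') f g → HomLeq Q (dS Q d') (f *) (g *))
    × (∀ (X : Set) (d : X → X → Quantale.Carrier Q) → IsQMetric Q d →
    ∀ (A : Pred X 0ℓ) → (η *) A ≐ A)
    × (∀ (X X' : Set) (d : X → X → Quantale.Carrier Q) (d' : X' → X' → Quantale.Carrier Q) →
    IsQMetric Q d → IsQMetric Q d' →
    (f : X → Pred X' 0ℓ) → IsShort Q d (dS Q d') f →
    ∀ (x : X) → (f *) (η x) ≐ f x)
    × (∀ (X X' X'' : Set) (d : X → X → Quantale.Carrier Q) (d' : X' → X' → Quantale.Carrier Q)
    (d'' : X'' → X'' → Quantale.Carrier Q) →
    IsQMetric Q d → IsQMetric Q d' → IsQMetric Q d'' →
    (f : X → Pred X' 0ℓ) → IsShort Q d (dS Q d') f →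
    (g : X' → Pred X'' 0ℓ) → IsShort Q d' (dS Q d'') g →
    ∀ (A : Pred X 0ℓ) → (g *) ((f *) A) ≐ ((λ x → (g *) (f x)) *) A)
proposition9 Q =
    (λ X d → dS-isQMetric d)
  , (λ X d _ → η-short d)
  , (λ X X' d d' _ _ → *-short d d')
  , (λ X X' d d' _ _ f g _ _ → *-monotone d' f g)
  , (λ X d _ → η-*)
  , (λ X X' d d' _ _ f _ → *-η f)
  , (λ X X' X'' d d' d'' _ _ _ f _ g _ → *-assoc f g)
  where
    open HausdorffDistance Q
    open KleisliExtension Q
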